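{- Let $q$ be a power of an odd prime and let $m,d$ be positive integers with $q-1=md$ and $d$ even. Let $H_0$ be the subgroup of $\mathbb{F}_q^{\ast}$ of order $m$, and let $u,v$ be two different elements of $H_0$, of multiplicative orders $m_0$ and $m_1$ respectively; write $n_0=m/m_0$ and $n_1=m/m_1$. Put $a=(v-u)/2$, $b=(u+v)/2$ and $f(x)=ax^{(q+1)/2}+bx\in\mathbb{F}_q[x]$. Then: (i) $f$ is a permutation polynomial of $\mathbb{F}_q$; (ii) the permutation induced by $f$ has cycle type $1+m_0^{dn_0/2}+m_1^{dn_1/2}$; (iii) the inverse permutation is induced by the binomial $a'x^{(q+1)/2}+b'x$, where $a'=(v^{ -1}-u^{ -1})/2$ and $b'=(u^{ -1}+v^{ -1})/2$.
   Context: The order of a nonzero element of $\mathbb{F}_q$ means its order in $\mathbb{F}_q^{\ast}$. A cycle type written $1+m_0^{k_0}+m_1^{k_1}$ means the permutation has exactly one fixed point and otherwise consists of $k_0$ disjoint cycles of length $m_0$ and $k_1$ disjoint cycles of length $m_1$ (if $m_0=m_1$ these counts add). -}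

module Defs where

open import Level using (0ℓ)
open import Data.Nat as ℕ using (ℕ; zero; suc; _≤_; _<_; _≡ᵇ_; _∸_)
open import Data.Bool using (Bool; true; false; _∧_; not; if_then_else_)
open import Data.Fin using (Fin)
open import Data.List using (List; []; _∷_; map; allFin)
open import Data.Empty using (⊥)
open import Relation.Nullary using (¬_; Dec; yes; no)
open import Relation.Binary.PropositionalEquality using (_≡_; _≢_)
open import Relation.Binary.Definitions using (DecidableEquality)
open import Function.Bundles using (_↔_; Inverse)
open import Algebra.Structures using (IsCommutativeRing)

-- The multiplicative inverse is total (0⁻¹ is unconstrained); it is only
-- required to be an inverse on nonzero elements.
record FiniteField (q : ℕ) : Set₁ where
  infixl 6 _+_ _-_
  infixl 7 _*_
  infix 8 -_ _⁻¹
  field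
    Carrier : Set
    _+_ _*_ : Carrier → Carrier → Carrier
    -_      : Carrier → Carrier
    _⁻¹     : Carrier → Carrier
    0# 1#   : Carrier
    isCommutativeRing : IsCommutativeRing _≡_ _+_ _*_ -_ 0# 1#
    0≢1     : 0# ≢ 1#
    ⁻¹-inverse : ∀ x → x ≢ 0# → x * (x ⁻¹) ≡ 1#
    _≟_     : DecidableEquality Carrier
    enumeration : Carrier ↔ Fin q

  _-_ : Carrier → Carrier → Carrier
  x - y = x + (- y)

  _÷_ : Carrier → Carrier → Carrier
  x ÷ y = x * (y ⁻¹)

  2# : Carrier
  2# = 1# + 1#

  _^_ : Carrier → ℕ → Carrier
  x ^ zero  = 1#
  x ^ suc n = x * (x ^ n)

  elements : List Carrier
  elements = map (Inverse.from enumeration) (allFin q)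

  _==_ : Carrier → Carrier → Bool
  x == y with x ≟ y
  ... | yes _ = true
  ... | no  _ = false

  HasOrder : Carrier → ℕ → Set
  HasOrder x k = (1 ≤ k) × (x ^ k ≡ 1#) × (∀ j → 1 ≤ j → j < k → x ^ j ≢ 1#)
    where open import Data.Product using (_×_)

  record IsSubgroupOfUnits (H : Carrier → Bool) : Set where
    field
      nonzero : ∀ x → H x ≡ true → x ≢ 0#
      one     : H 1# ≡ true
      mul     : ∀ x y → H x ≡ true → H y ≡ true → H (x * y) ≡ true
      inv     : ∀ x → H x ≡ true → H (x ⁻¹) ≡ true

countB : {A : Set} → (A → Bool) → List A → ℕ
countB p [] = 0
countB p (x ∷ xs) = if p x then suc (countB p xs) else countB p xs

iter : {A : Set} → (A → A) → ℕ → A → A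
iter f zero x = x
iter f (suc n) x = f (iter f n x)

-- all j with 1 ≤ j < ℓ satisfy p j
allBelow : (ℕ → Bool) → ℕ → Bool
allBelow p zero = true
allBelow p (suc ℓ) = allBelow p ℓ ∧ (if ℓ ≡ᵇ 0 then true else p ℓ)

module Cycles {A : Set} (_==_ : A → A → Bool) (σ : A → A) where
  onCycleOfLength : ℕ → A → Bool
  onCycleOfLength zero x = false
  onCycleOfLength (suc k) x =
    (iter σ (suc k) x == x) ∧ allBelow (λ j → not (iter σ j x == x)) (suc k)

-- For a permutation σ of a finite set with element list `els`, the number
-- of points lying on cycles of length ℓ; σ has exactly c ℓ cycles of length ℓ
-- iff this equals ℓ * c ℓ for every ℓ.
pointsOnCycles : {A : Set} → (A → A → Bool) → (A → A) → List A → ℕ → ℕ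
pointsOnCycles _==_ σ els ℓ = countB (Cycles.onCycleOfLength _==_ σ ℓ) els

-- cycle type 1 + m₀^{k₀} + m₁^{k₁} as a function ℓ ↦ number of ℓ-cycles
-- (the contributions add when lengths coincide)
cycleType1+ : ℕ → ℕ → ℕ → ℕ → ℕ → ℕ
cycleType1+ m₀ k₀ m₁ k₁ ℓ =
  (if ℓ ≡ᵇ 1 then 1 else 0) ℕ.+ (if ℓ ≡ᵇ m₀ then k₀ else 0) ℕ.+ (if ℓ ≡ᵇ m₁ then k₁ else 0)

-- Write q = 2K + 1 with K = m d / 2.  Every unit x satisfies x^(2K) = 1, so x^K = ±1, and
-- f(x) = (a x^K + b) x equals v x when x^K = 1 and u x when x^K = −1, while f(0) = 0.  The orders
-- of u and v divide m, hence K, so u^K = v^K = 1 and multiplication by u (by v) maps each class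
-- x^K = −1 (x^K = 1) to itself.  Thus f acts on the two classes as multiplication by u and by v:
-- it is inverted by the same construction with u⁻¹, v⁻¹, and every point of the first class lies
-- on a cycle of length m₀, every point of the second on one of length m₁.  Each class has exactly
-- K elements: x^K = ±1 each have at most K roots, and together they exhaust the 2K units.
module Submission where

open import Defs
open import Data.Nat using (ℕ; _≤_; _∸_; _/_)
import Data.Nat as ℕ
import Data.Nat.Properties as ℕ
open import Data.Nat.Divisibility using (_∣_; divides)
open import Data.Nat.Primality using (Prime)
open import Data.Bool using (Bool; true)
open import Data.Product using (_×_; ∃; ∃-syntax; _,_)
open import Relation.Nullary using (¬_)
open import Relation.Binary.PropositionalEquality using (_≡_; _≢_; sym; trans; cong)
open import Function.Definitions using (Bijective)

module Arithmetic where
  open import Data.Bool using (false; if_then_else_; T)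
  open import Data.Fin using (Fin)
  open import Data.Nat using (suc; _+_; _*_; _≡ᵇ_)
  import Data.Nat.Properties as ℕ
  open import Data.Nat.DivMod using (m*n/n≡m)
  open import Data.Nat.Divisibility using (divides; ∣1⇒≡1; ∣m+n∣m⇒∣n)
  open import Data.Nat.Tactic.RingSolver using (solve-∀)
  open import Relation.Binary.PropositionalEquality

  toℕ : Bool → ℕ
  toℕ true  = 1
  toℕ false = 0

  n+n≡n*2 : ∀ n → n + n ≡ n * 2
  n+n≡n*2 n = trans (cong (n +_) (sym (ℕ.+-identityʳ n))) (ℕ.*-comm 2 n)

  odd⇒¬2∣ : ∀ n → ¬ 2 ∣ suc (n + n)
  odd⇒¬2∣ n 2∣1+2n
    with () ← ∣1⇒≡1 (∣m+n∣m⇒∣n (subst (2 ∣_) (ℕ.+-comm 1 (n + n)) 2∣1+2n) (divides n (n+n≡n*2 n)))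

  m+o≡n+n⇒m≡n : ∀ {m n o} → m ≤ n → o ≤ n → m + o ≡ n + n → m ≡ n
  m+o≡n+n⇒m≡n {m} {n} {o} m≤n o≤n m+o≡n+n =
    ℕ.≤-antisym m≤n (ℕ.+-cancelʳ-≤ n n m (subst (_≤ m + n) m+o≡n+n (ℕ.+-monoʳ-≤ m o≤n)))

  Fin⇒n≡1+[n∸1] : ∀ {n} → Fin n → n ≡ suc (n ∸ 1)
  Fin⇒n≡1+[n∸1] {suc n} _ = refl

  [1+2n+1]/2≡1+n : ∀ n → (suc (n + n) + 1) / 2 ≡ suc n
  [1+2n+1]/2≡1+n n = trans (cong (_/ 2) (trans (ℕ.+-comm (suc (n + n)) 1) 2+2n≡[1+n]*2)) (m*n/n≡m (suc n) 2)
    where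
    2+2n≡[1+n]*2 : suc (suc (n + n)) ≡ suc n * 2
    2+2n≡[1+n]*2 = trans (cong suc (sym (ℕ.+-suc n n))) (n+n≡n*2 (suc n))

  ℓ*[ℓ≡ᵇc]k≡ck[ℓ≡ᵇc] : ∀ ℓ c k → ℓ * (if ℓ ≡ᵇ c then k else 0) ≡ c * k * toℕ (ℓ ≡ᵇ c)
  ℓ*[ℓ≡ᵇc]k≡ck[ℓ≡ᵇc] ℓ c k with ℓ ≡ᵇ c in ℓ≡ᵇc
  ... | true  rewrite ℕ.≡ᵇ⇒≡ ℓ c (subst T (sym ℓ≡ᵇc) _) = sym (ℕ.*-identityʳ (c * k))
  ... | false = trans (ℕ.*-zeroʳ ℓ) (sym (ℕ.*-zeroʳ (c * k)))

  ℓ*cycleType1+ : ∀ ℓ m₀ k₀ m₁ k₁ → ℓ * cycleType1+ m₀ k₀ m₁ k₁ ℓ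
    ≡ 1 * toℕ (ℓ ≡ᵇ 1) + m₀ * k₀ * toℕ (ℓ ≡ᵇ m₀) + m₁ * k₁ * toℕ (ℓ ≡ᵇ m₁)
  ℓ*cycleType1+ ℓ m₀ k₀ m₁ k₁ = begin
    ℓ * (ones + c₀ + c₁)                  ≡⟨ ℕ.*-distribˡ-+ ℓ (ones + c₀) c₁ ⟩
    ℓ * (ones + c₀) + ℓ * c₁              ≡⟨ cong (_+ ℓ * c₁) (ℕ.*-distribˡ-+ ℓ ones c₀) ⟩
    ℓ * ones + ℓ * c₀ + ℓ * c₁            ≡⟨ cong₂ _+_ (cong₂ _+_ (ℓ*[ℓ≡ᵇc]k≡ck[ℓ≡ᵇc] ℓ 1 1) (ℓ*[ℓ≡ᵇc]k≡ck[ℓ≡ᵇc] ℓ m₀ k₀))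
                                                        (ℓ*[ℓ≡ᵇc]k≡ck[ℓ≡ᵇc] ℓ m₁ k₁) ⟩
    1 * 1 * toℕ (ℓ ≡ᵇ 1) + m₀ * k₀ * toℕ (ℓ ≡ᵇ m₀) + m₁ * k₁ * toℕ (ℓ ≡ᵇ m₁) ∎
    where
    open ≡-Reasoning
    ones = if ℓ ≡ᵇ 1 then 1 else 0
    c₀ = if ℓ ≡ᵇ m₀ then k₀ else 0
    c₁ = if ℓ ≡ᵇ m₁ then k₁ else 0

  m*[t*2*n/2]≡[m*n]*t : ∀ m n t → m * (t * 2 * n / 2) ≡ m * n * t
  m*[t*2*n/2]≡[m*n]*t m n t = begin
    m * (t * 2 * n / 2)   ≡⟨ cong (λ k → m * (k / 2)) (regroup t n) ⟩
    m * (t * n * 2 / 2)   ≡⟨ cong (m *_) (m*n/n≡m (t * n) 2) ⟩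
    m * (t * n)           ≡⟨ regroup′ m n t ⟩
    m * n * t             ∎
    where
    open ≡-Reasoning
    regroup : ∀ t n → t * 2 * n ≡ t * n * 2
    regroup = solve-∀
    regroup′ : ∀ m n t → m * (t * n) ≡ m * n * t
    regroup′ = solve-∀

open Arithmetic

module Counting where
  open import Data.Bool using (false; not; _∧_; T?)
  import Data.Bool.Properties as Bool
  open import Data.Empty using (⊥-elim)
  open import Data.Fin as Fin using (Fin)
  import Data.Fin.Properties as Fin
  open import Data.List using (List; []; _∷_; map; length; allFin; filter)
  import Data.List.Properties as List
  open import Data.List.Membership.Propositional using (_∈_)
  open import Data.List.Membership.Propositional.Properties using (∈-map⁺; ∈-allFin)
  open import Data.List.Membership.Propositional.Properties.WithK using (unique∧set⇒bag)
  open import Data.List.Relation.Binary.BagAndSetEquality using (∼bag⇒↭)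
  open import Data.List.Relation.Binary.Permutation.Propositional using (_↭_; ↭⇒↭ₛ)
  import Data.List.Relation.Binary.Permutation.Setoid.Properties as Perm
  open import Data.List.Relation.Unary.All as All using (All; []; _∷_)
  open import Data.List.Relation.Unary.AllPairs using (_∷_)
  open import Data.List.Relation.Unary.Any using (here; there)
  open import Data.List.Relation.Unary.Unique.Propositional using (Unique)
  import Data.List.Relation.Unary.Unique.Propositional.Properties as Unique
  open import Data.Nat using (zero; suc; _+_; _*_; _<_; _≡ᵇ_; z≤n; s≤s)
  import Data.Nat.Properties as ℕ
  open import Data.Nat.Divisibility using (divides)
  open import Data.Nat.Tactic.RingSolver using (solve-∀)
  open import Data.Sum using (inj₁; inj₂)
  open import Function using (_∘_; _⇔_; mk⇔)
  open import Function.Bundles using (_↔_; Inverse)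
  open import Relation.Binary.Definitions using (tri<; tri≈; tri>; DecidableEquality)
  open import Relation.Binary.PropositionalEquality
  open import Relation.Nullary using (Dec; yes; does)
  open import Relation.Nullary.Decidable using (dec-true; dec-false)
  open import Relation.Unary using (Decidable)

  data OneHot : Bool → Bool → Bool → Set where
    first  : OneHot true false false
    second : OneHot false true false
    third  : OneHot false false true

  module _ {A : Set} where

    countB-cons : ∀ (p : A → Bool) x xs → countB p (x ∷ xs) ≡ toℕ (p x) + countB p xs
    countB-cons p x xs with p x
    ... | true  = refl
    ... | false = refl

    countB≡length∘filter : ∀ {P : A → Set} (P? : Decidable P) xs → countB (does ∘ P?) xs ≡ length (filter P? xs)
    countB≡length∘filter P? [] = refl
    countB≡length∘filter P? (x ∷ xs) with does (P? x)
    ... | true  = cong suc (countB≡length∘filter P? xs)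
    ... | false = countB≡length∘filter P? xs

    countB-cong : ∀ {p r : A → Bool} → (∀ x → p x ≡ r x) → ∀ xs → countB p xs ≡ countB r xs
    countB-cong p≗r [] = refl
    countB-cong {p} {r} p≗r (x ∷ xs) rewrite countB-cons p x xs | countB-cons r x xs | p≗r x =
      cong (toℕ (r x) +_) (countB-cong p≗r xs)

    countB-map : ∀ (p : A → Bool) (σ : A → A) xs → countB p (map σ xs) ≡ countB (p ∘ σ) xs
    countB-map p σ [] = refl
    countB-map p σ (x ∷ xs) rewrite countB-cons p (σ x) (map σ xs) | countB-cons (p ∘ σ) x xs =
      cong (toℕ (p (σ x)) +_) (countB-map p σ xs)

    countB-+-countB-not : ∀ (p : A → Bool) xs → countB p xs + countB (not ∘ p) xs ≡ length xs
    countB-+-countB-not p [] = refl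
    countB-+-countB-not p (x ∷ xs) with p x
    ... | true  = cong suc (countB-+-countB-not p xs)
    ... | false = trans (ℕ.+-suc _ _) (cong suc (countB-+-countB-not p xs))

    countB-↭ : ∀ (p : A → Bool) {xs ys} → xs ↭ ys → countB p xs ≡ countB p ys
    countB-↭ p {xs} {ys} xs↭ys = begin
      countB p xs                ≡⟨ countB≡length∘filter (T? ∘ p) xs ⟩
      length (filter (T? ∘ p) xs)
        ≡⟨ Perm.xs↭ys⇒|xs|≡|ys| (setoid A) (Perm.filter⁺ (setoid A) (T? ∘ p) (λ { refl t → t }) (↭⇒↭ₛ xs↭ys)) ⟩
      length (filter (T? ∘ p) ys) ≡⟨ countB≡length∘filter (T? ∘ p) ys ⟨
      countB p ys                ∎
      where open ≡-Reasoning

    countB-linear₃ : ∀ (p z s r : A → Bool) (c₁ c₂ c₃ : ℕ) →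
      (∀ x → toℕ (p x) ≡ toℕ (z x) * c₁ + toℕ (s x) * c₂ + toℕ (r x) * c₃) →
      ∀ xs → countB p xs ≡ countB z xs * c₁ + countB s xs * c₂ + countB r xs * c₃
    countB-linear₃ p z s r c₁ c₂ c₃ pointwise [] = refl
    countB-linear₃ p z s r c₁ c₂ c₃ pointwise (x ∷ xs)
      rewrite countB-cons p x xs | countB-cons z x xs | countB-cons s x xs | countB-cons r x xs
            | pointwise x | countB-linear₃ p z s r c₁ c₂ c₃ pointwise xs =
      regroup (toℕ (z x)) (toℕ (s x)) (toℕ (r x)) (countB z xs) (countB s xs) (countB r xs) c₁ c₂ c₃
      where
      regroup : ∀ a b c a′ b′ c′ k₁ k₂ k₃ →
        (a * k₁ + b * k₂ + c * k₃) + (a′ * k₁ + b′ * k₂ + c′ * k₃)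
          ≡ (a + a′) * k₁ + (b + b′) * k₂ + (c + c′) * k₃
      regroup = solve-∀

    countB-none : ∀ (p : A → Bool) {xs} → All (λ x → p x ≡ false) xs → countB p xs ≡ 0
    countB-none p []              = refl
    countB-none p (px≡false ∷ ps) rewrite px≡false = countB-none p ps

    countB-partition₃ : ∀ (z s r : A → Bool) → (∀ x → OneHot (z x) (s x) (r x)) →
      ∀ (p : A → Bool) {b₁ b₂ b₃} →
      (∀ x → z x ≡ true → p x ≡ b₁) → (∀ x → s x ≡ true → p x ≡ b₂) → (∀ x → r x ≡ true → p x ≡ b₃) →
      ∀ xs → countB p xs ≡ countB z xs * toℕ b₁ + countB s xs * toℕ b₂ + countB r xs * toℕ b₃
    countB-partition₃ z s r one-hot p {b₁} {b₂} {b₃} on-z on-s on-r =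
      countB-linear₃ p z s r (toℕ b₁) (toℕ b₂) (toℕ b₃) pointwise
      where
      pointwise : ∀ x → toℕ (p x) ≡ toℕ (z x) * toℕ b₁ + toℕ (s x) * toℕ b₂ + toℕ (r x) * toℕ b₃
      pointwise x with z x in zx | s x in sx | r x in rx | one-hot x
      ... | _ | _ | _ | first  rewrite on-z x zx = sym (trans (ℕ.+-identityʳ _) (trans (ℕ.+-identityʳ _) (ℕ.+-identityʳ _)))
      ... | _ | _ | _ | second rewrite on-s x sx = sym (trans (ℕ.+-identityʳ _) (ℕ.+-identityʳ _))
      ... | _ | _ | _ | third  rewrite on-r x rx = sym (ℕ.+-identityʳ _)

    countB-true : ∀ xs → countB (λ (_ : A) → true) xs ≡ length xs
    countB-true []       = refl
    countB-true (x ∷ xs) = cong suc (countB-true xs)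

  ↭-unique : ∀ {A : Set} {xs ys : List A} → Unique xs → Unique ys → (∀ {z} → z ∈ xs ⇔ z ∈ ys) → xs ↭ ys
  ↭-unique xs! ys! same = ∼bag⇒↭ (unique∧set⇒bag xs! ys! same)

  module Enumeration {A : Set} {n : ℕ} (e : A ↔ Fin n) where
    open Inverse e

    enumerate : List A
    enumerate = map from (allFin n)

    from-injective : ∀ {i j} → from i ≡ from j → i ≡ j
    from-injective {i} {j} eq = trans (sym (strictlyInverseˡ i)) (trans (cong to eq) (strictlyInverseˡ j))

    enumerate-unique : Unique enumerate
    enumerate-unique = Unique.map⁺ from-injective (Unique.allFin⁺ n)

    ∈-enumerate : ∀ x → x ∈ enumerate
    ∈-enumerate x = subst (_∈ enumerate) (strictlyInverseʳ x) (∈-map⁺ from (∈-allFin (to x)))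

    length-enumerate : length enumerate ≡ n
    length-enumerate = trans (List.length-map from (allFin n)) (List.length-tabulate (λ i → i))

    ↭-enumerate : ∀ {xs} → Unique xs → (∀ x → x ∈ xs) → xs ↭ enumerate
    ↭-enumerate xs! complete = ↭-unique xs! enumerate-unique (mk⇔ (λ _ → ∈-enumerate _) (λ _ → complete _))

    to-injective : ∀ {x y} → to x ≡ to y → x ≡ y
    to-injective {x} {y} eq = trans (sym (strictlyInverseʳ x)) (trans (cong from eq) (strictlyInverseʳ y))

    -- Orient each pair {x, σ x} by comparing indices: exactly one of the two lies below its partner.
    involution-even : (σ : A → A) → (∀ x → σ (σ x) ≡ x) → (∀ x → σ x ≢ x) → 2 ∣ n
    involution-even σ σσ≡id no-fixpoint = divides half (begin
      n                                                        ≡⟨ length-enumerate ⟨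
      length enumerate                                         ≡⟨ countB-+-countB-not below enumerate ⟨
      half + countB (not ∘ below) enumerate                    ≡⟨ cong (half +_) below-balanced ⟩
      half + half                                              ≡⟨ n+n≡n*2 half ⟩
      half * 2                                                 ∎)
      where
      open ≡-Reasoning
      below : A → Bool
      below x = does (to x Fin.<? to (σ x))

      half : ℕ
      half = countB below enumerate

      below-flips : ∀ x → below (σ x) ≡ not (below x)
      below-flips x rewrite σσ≡id x with Fin.<-cmp (to x) (to (σ x))
      ... | tri< lt _ _ = trans (dec-false (_ Fin.<? _) (Fin.<-asym lt)) (cong not (sym (dec-true (_ Fin.<? _) lt)))
      ... | tri≈ _ eq _ = ⊥-elim (no-fixpoint x (sym (to-injective eq)))
      ... | tri> _ _ gt = trans (dec-true (_ Fin.<? _) gt) (cong not (sym (dec-false (_ Fin.<? _) (Fin.<-asym gt))))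

      σ-injective : ∀ {x y} → σ x ≡ σ y → x ≡ y
      σ-injective {x} {y} eq = trans (sym (σσ≡id x)) (trans (cong σ eq) (σσ≡id y))

      σ-permutes : map σ enumerate ↭ enumerate
      σ-permutes = ↭-enumerate (Unique.map⁺ σ-injective enumerate-unique)
        (λ x → subst (_∈ map σ enumerate) (σσ≡id x) (∈-map⁺ σ (∈-enumerate (σ x))))

      below-balanced : countB (not ∘ below) enumerate ≡ half
      below-balanced = begin
        countB (not ∘ below) enumerate ≡⟨ countB-cong below-flips enumerate ⟨
        countB (below ∘ σ) enumerate   ≡⟨ countB-map below σ enumerate ⟨
        countB below (map σ enumerate) ≡⟨ countB-↭ below σ-permutes ⟩
        half                           ∎

  module _ {A : Set} (_≟_ : DecidableEquality A) where

    countB-≟-unique : ∀ {y xs} → Unique xs → y ∈ xs → countB (λ x → does (x ≟ y)) xs ≡ 1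
    countB-≟-unique {y} (y∉xs ∷ xs!) (here refl) rewrite dec-true (y ≟ y) refl =
      cong suc (countB-none _ (All.map (λ y≢x → dec-false (_ ≟ y) (y≢x ∘ sym)) y∉xs))
    countB-≟-unique {y} (x∉xs ∷ xs!) (there y∈xs) rewrite dec-false (_ ≟ y) (All.lookup x∉xs y∈xs) =
      countB-≟-unique xs! y∈xs

  allBelow-intro : ∀ p n → (∀ j → 1 ≤ j → j < n → p j ≡ true) → allBelow p n ≡ true
  allBelow-intro p zero          all = refl
  allBelow-intro p (suc zero)    all = refl
  allBelow-intro p (suc (suc n)) all
    rewrite allBelow-intro p (suc n) (λ j 1≤j j<n → all j 1≤j (ℕ.m≤n⇒m≤1+n j<n)) | all (suc n) (s≤s z≤n) ℕ.≤-refl = refl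

  allBelow-elim : ∀ p n → allBelow p n ≡ true → ∀ j → 1 ≤ j → j < n → p j ≡ true
  allBelow-elim p (suc n) all j 1≤j (s≤s j≤n) with allBelow p n in below-n | ℕ.m≤n⇒m<n∨m≡n j≤n
  ... | true | inj₁ j<n = allBelow-elim p n below-n j 1≤j j<n
  allBelow-elim p (suc (suc j)) all (suc j) 1≤j _ | true | inj₂ refl = all

  module _ {A : Set} (_==_ : A → A → Bool) (σ : A → A) where
    open Cycles _==_ σ

    onCycleOfLength-period : ∀ x m → 1 ≤ m → (iter σ m x == x) ≡ true →
      (∀ j → 1 ≤ j → j < m → (iter σ j x == x) ≡ false) →
      ∀ ℓ → onCycleOfLength ℓ x ≡ (ℓ ≡ᵇ m)
    onCycleOfLength-period x m 1≤m returns minimal zero = sym (dec-false (0 ℕ.≟ m) (ℕ.<⇒≢ 1≤m))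
    onCycleOfLength-period x m 1≤m returns minimal (suc ℓ) with ℕ.<-cmp (suc ℓ) m
    ... | tri< ℓ<m ℓ≢m _ rewrite minimal (suc ℓ) (s≤s z≤n) ℓ<m = sym (dec-false (suc ℓ ℕ.≟ m) ℓ≢m)
    ... | tri≈ _ refl _ rewrite returns | dec-true (suc ℓ ℕ.≟ suc ℓ) refl =
      allBelow-intro _ (suc ℓ) (λ j 1≤j j<m → cong not (minimal j 1≤j j<m))
    ... | tri> _ ℓ≢m m<ℓ rewrite dec-false (suc ℓ ℕ.≟ m) ℓ≢m =
      trans (cong ((iter σ (suc ℓ) x == x) ∧_) passes-m) (Bool.∧-zeroʳ _)
      where
      passes-m : allBelow (λ j → not (iter σ j x == x)) (suc ℓ) ≡ false
      passes-m with allBelow (λ j → not (iter σ j x == x)) (suc ℓ) in all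
      ... | false = refl
      ... | true with () ← trans (cong not (sym returns)) (allBelow-elim _ (suc ℓ) all m 1≤m m<ℓ)

  iter-preserves : ∀ {A : Set} (P : A → Set) (f : A → A) → (∀ {x} → P x → P (f x)) →
    ∀ {x} → P x → ∀ j → P (iter f j x)
  iter-preserves P f preserves Px zero    = Px
  iter-preserves P f preserves Px (suc j) = preserves (iter-preserves P f preserves Px j)

  does⇒witness : ∀ {P : Set} (P? : Dec P) → does P? ≡ true → P
  does⇒witness (yes p) _ = p

open Counting

module FiniteFieldProperties {q : ℕ} (F : FiniteField q) where
  open import Algebra.Bundles using (CommutativeRing)
  open import Algebra.Structures using (IsCommutativeRing)
  import Algebra.Properties.Group as GroupProperties
  open import Data.Bool using (Bool; true; false; not)
  open import Data.Empty using (⊥-elim)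
  open import Data.List using (List; []; _∷_; map; length; filter; foldr; replicate)
  import Data.List.Properties as List
  open import Data.List.Membership.Propositional using (_∈_)
  open import Data.List.Membership.Propositional.Properties using (∈-map⁺; ∈-map⁻; ∈-filter⁺; ∈-filter⁻)
  open import Data.List.Relation.Binary.Permutation.Propositional using (_↭_; ↭⇒↭ₛ)
  import Data.List.Relation.Binary.Permutation.Setoid.Properties as Perm
  open import Data.List.Relation.Unary.All as All using (All; []; _∷_)
  open import Data.List.Relation.Unary.AllPairs using ([]; _∷_)
  open import Data.List.Relation.Unary.Unique.Propositional using (Unique)
  import Data.List.Relation.Unary.Unique.Propositional.Properties as Unique
  open import Data.Nat as ℕ using (ℕ; zero; suc; _≤_; z≤n; s≤s)
  import Data.Nat.Properties as ℕ
  open import Data.Nat.Divisibility using (_∣_)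
  open import Data.Product using (_×_; _,_; proj₂)
  open import Data.Sum using (_⊎_; inj₁; inj₂)
  open import Function using (_∘_; mk⇔)
  open import Function.Bundles using (Inverse)
  open import Relation.Binary.PropositionalEquality
  open import Relation.Nullary using (¬_; does; yes; no; ¬?)
  open import Relation.Nullary.Decidable using (dec-true; dec-false)
  open FiniteField F
  open IsCommutativeRing isCommutativeRing
    using (+-assoc; +-comm; *-assoc; *-comm; zeroˡ; zeroʳ; +-identityˡ; +-identityʳ;
           *-identityˡ; *-identityʳ; -‿inverseˡ; -‿inverseʳ; *-isCommutativeMonoid)
  open ≡-Reasoning

  commutativeRing : CommutativeRing _ _
  commutativeRing = record { isCommutativeRing = isCommutativeRing }

  open CommutativeRing commutativeRing using (commutativeSemiring; +-group)
  open import Algebra.Solver.Ring.NaturalCoefficients.Default commutativeSemiring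
  open GroupProperties +-group using (x∙y⁻¹≈ε⇒x≈y; ⁻¹-involutive; identityʳ-unique)

  -- The ring solver opened above has natural-number coefficients, so it treats - c as an atom: identities
  -- involving negation are proved with an extra summand (- c + c) * y, removed by this lemma.
  x+0*y≡x : ∀ {z} x y → z ≡ 0# → x + z * y ≡ x
  x+0*y≡x x y z≡0 = trans (cong (λ z → x + z * y) z≡0) (trans (cong (x +_) (zeroˡ y)) (+-identityʳ x))

  ⁻¹-inverseˡ : ∀ {x} → x ≢ 0# → x ⁻¹ * x ≡ 1#
  ⁻¹-inverseˡ {x} x≢0 = trans (*-comm (x ⁻¹) x) (⁻¹-inverse x x≢0)

  x*[y*z]≡z : ∀ {x y} → x * y ≡ 1# → ∀ z → x * (y * z) ≡ z
  x*[y*z]≡z {x} {y} xy≡1 z = begin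
    x * (y * z) ≡⟨ *-assoc x y z ⟨
    x * y * z   ≡⟨ cong (_* z) xy≡1 ⟩
    1# * z      ≡⟨ *-identityˡ z ⟩
    z           ∎

  *-cancelˡ : ∀ {x y z} → x ≢ 0# → x * y ≡ x * z → y ≡ z
  *-cancelˡ {x} {y} {z} x≢0 eq = begin
    y              ≡⟨ x*[y*z]≡z (⁻¹-inverseˡ x≢0) y ⟨
    x ⁻¹ * (x * y) ≡⟨ cong (x ⁻¹ *_) eq ⟩
    x ⁻¹ * (x * z) ≡⟨ x*[y*z]≡z (⁻¹-inverseˡ x≢0) z ⟩
    z              ∎

  x*y≡0⇒y≡0 : ∀ {x y} → x ≢ 0# → x * y ≡ 0# → y ≡ 0#
  x*y≡0⇒y≡0 {x} x≢0 eq = *-cancelˡ x≢0 (trans eq (sym (zeroʳ x)))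

  *-≢0 : ∀ {x y} → x ≢ 0# → y ≢ 0# → x * y ≢ 0#
  *-≢0 x≢0 y≢0 = y≢0 ∘ x*y≡0⇒y≡0 x≢0

  ⁻¹-≢0 : ∀ {x} → x ≢ 0# → x ⁻¹ ≢ 0#
  ⁻¹-≢0 {x} x≢0 x⁻¹≡0 = 0≢1 (begin
    0#       ≡⟨ zeroʳ x ⟨
    x * 0#   ≡⟨ cong (x *_) x⁻¹≡0 ⟨
    x * x ⁻¹ ≡⟨ ⁻¹-inverse x x≢0 ⟩
    1#       ∎)

  x*y≡y⇒x≡1 : ∀ {x y} → y ≢ 0# → x * y ≡ y → x ≡ 1#
  x*y≡y⇒x≡1 {x} {y} y≢0 eq = *-cancelˡ y≢0 (trans (*-comm y x) (trans eq (sym (*-identityʳ y))))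

  -1≢0 : - 1# ≢ 0#
  -1≢0 -1≡0 = 0≢1 (begin
    0#        ≡⟨ -‿inverseʳ 1# ⟨
    1# - 1#   ≡⟨ cong (1# +_) -1≡0 ⟩
    1# + 0#   ≡⟨ +-identityʳ 1# ⟩
    1#        ∎)

  1≢-1 : 2# ≢ 0# → 1# ≢ - 1#
  1≢-1 2≢0 1≡-1 = 2≢0 (trans (cong (1# +_) 1≡-1) (-‿inverseʳ 1#))

  x*x≡1⇒x≡±1 : ∀ x → x * x ≡ 1# → x ≡ 1# ⊎ x ≡ - 1#
  x*x≡1⇒x≡±1 x x²≡1 with (x - 1#) ≟ 0#
  ... | yes x-1≡0 = inj₁ (x∙y⁻¹≈ε⇒x≈y x 1# x-1≡0)
  ... | no  x-1≢0 = inj₂ (x∙y⁻¹≈ε⇒x≈y x (- 1#) (trans (cong (x +_) (⁻¹-involutive 1#)) x+1≡0))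
    where
    factor : (x - 1#) * (x + 1#) ≡ x * x - 1#
    factor = begin
      (x - 1#) * (x + 1#)
        ≡⟨ solve 2 (λ x n → (x :+ n) :* (x :+ con 1) := (x :* x :+ n) :+ (n :+ con 1) :* x) refl x (- 1#) ⟩
      x * x - 1# + (- 1# + 1#) * x   ≡⟨ x+0*y≡x _ x (-‿inverseˡ 1#) ⟩
      x * x - 1#                     ∎
    x+1≡0 : x + 1# ≡ 0#
    x+1≡0 = x*y≡0⇒y≡0 x-1≢0 (trans factor (trans (cong (_- 1#) x²≡1) (-‿inverseʳ 1#)))

  ^-homo-* : ∀ x m n → x ^ (m ℕ.+ n) ≡ x ^ m * x ^ n
  ^-homo-* x zero    n = sym (*-identityˡ _)
  ^-homo-* x (suc m) n = trans (cong (x *_) (^-homo-* x m n)) (sym (*-assoc x _ _))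

  ^-distrib-* : ∀ x y n → (x * y) ^ n ≡ x ^ n * y ^ n
  ^-distrib-* x y zero    = sym (*-identityˡ 1#)
  ^-distrib-* x y (suc n) = trans (cong ((x * y) *_) (^-distrib-* x y n))
    (solve 4 (λ x y xⁿ yⁿ → (x :* y) :* (xⁿ :* yⁿ) := (x :* xⁿ) :* (y :* yⁿ)) refl x y (x ^ n) (y ^ n))

  1^n≡1 : ∀ n → 1# ^ n ≡ 1#
  1^n≡1 zero    = refl
  1^n≡1 (suc n) = trans (*-identityˡ _) (1^n≡1 n)

  ^-assocʳ : ∀ x m n → (x ^ m) ^ n ≡ x ^ (m ℕ.* n)
  ^-assocʳ x zero    n = 1^n≡1 n
  ^-assocʳ x (suc m) n = begin
    (x * x ^ m) ^ n         ≡⟨ ^-distrib-* x (x ^ m) n ⟩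
    x ^ n * (x ^ m) ^ n     ≡⟨ cong (x ^ n *_) (^-assocʳ x m n) ⟩
    x ^ n * x ^ (m ℕ.* n)   ≡⟨ ^-homo-* x n (m ℕ.* n) ⟨
    x ^ (n ℕ.+ m ℕ.* n)     ∎

  0^n≡0 : ∀ {n} → 1 ≤ n → 0# ^ n ≡ 0#
  0^n≡0 (s≤s z≤n) = zeroˡ _

  x^n≡c⇒x≢0 : ∀ {x n c} → 1 ≤ n → c ≢ 0# → x ^ n ≡ c → x ≢ 0#
  x^n≡c⇒x≢0 1≤n c≢0 xⁿ≡c refl = c≢0 (trans (sym xⁿ≡c) (0^n≡0 1≤n))

  HasOrder⇒^*≡1 : ∀ {w m} → HasOrder w m → ∀ k → w ^ (m ℕ.* k) ≡ 1#
  HasOrder⇒^*≡1 {w} {m} (_ , wᵐ≡1 , _) k = trans (sym (^-assocʳ w m k)) (trans (cong (_^ k) wᵐ≡1) (1^n≡1 k))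

  ==-reflects : ∀ {x y} → (x == y) ≡ does (x ≟ y)
  ==-reflects {x} {y} with x ≟ y
  ... | yes _ = refl
  ... | no  _ = refl

  ==-true : ∀ {x y} → x ≡ y → (x == y) ≡ true
  ==-true x≡y = trans ==-reflects (dec-true (_ ≟ _) x≡y)

  ==-false : ∀ {x y} → x ≢ y → (x == y) ≡ false
  ==-false x≢y = trans ==-reflects (dec-false (_ ≟ _) x≢y)

  open Enumeration enumeration using (enumerate-unique; ∈-enumerate; length-enumerate)

  q≡1+[q∸1] : q ≡ suc (q ∸ 1)
  q≡1+[q∸1] = Fin⇒n≡1+[n∸1] (Inverse.to enumeration 0#)

  isZero : Carrier → Bool
  isZero x = does (x ≟ 0#)

  count-isZero : countB isZero elements ≡ 1
  count-isZero = countB-≟-unique _≟_ enumerate-unique (∈-enumerate 0#)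

  suc-count-nonzero : suc (countB (not ∘ isZero) elements) ≡ q
  suc-count-nonzero = begin
    suc (countB (not ∘ isZero) elements)                       ≡⟨ cong (ℕ._+ countB (not ∘ isZero) elements) count-isZero ⟨
    countB isZero elements ℕ.+ countB (not ∘ isZero) elements  ≡⟨ countB-+-countB-not isZero elements ⟩
    length elements                                             ≡⟨ length-enumerate ⟩
    q                                                           ∎

  -- A monic polynomial a₀ + a₁ x + ⋯ + aₙ₋₁ xⁿ⁻¹ + xⁿ is represented by the list [a₀, …, aₙ₋₁].
  evalMonic : List Carrier → Carrier → Carrier
  evalMonic []       x = 1#
  evalMonic (a ∷ as) x = a + x * evalMonic as x

  -- Synthetic division: the quotient of a ∷ as by x - r does not depend on a.
  divideByRoot : Carrier → List Carrier → List Carrier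
  divideByRoot r []       = []
  divideByRoot r (b ∷ bs) = evalMonic (b ∷ bs) r ∷ divideByRoot r bs

  length-divideByRoot : ∀ r as → length (divideByRoot r as) ≡ length as
  length-divideByRoot r []       = refl
  length-divideByRoot r (b ∷ bs) = cong suc (length-divideByRoot r bs)

  evalMonic-divideByRoot : ∀ r a as x →
    evalMonic (a ∷ as) x ≡ (x - r) * evalMonic (divideByRoot r as) x + evalMonic (a ∷ as) r
  evalMonic-divideByRoot r a [] x = begin
    a + x * 1#                          ≡⟨ x+0*y≡x _ 1# (-‿inverseˡ r) ⟨
    a + x * 1# + (- r + r) * 1#
      ≡⟨ solve 4 (λ a x r -r → a :+ x :* con 1 :+ (-r :+ r) :* con 1
                              := (x :+ -r) :* con 1 :+ (a :+ r :* con 1)) refl a x r (- r) ⟩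
    (x - r) * 1# + (a + r * 1#)         ∎
  evalMonic-divideByRoot r a (b ∷ bs) x = begin
    a + x * evalMonic (b ∷ bs) x        ≡⟨ cong (λ y → a + x * y) (evalMonic-divideByRoot r b bs x) ⟩
    a + x * ((x - r) * Q + c)           ≡⟨ x+0*y≡x _ c (-‿inverseˡ r) ⟨
    a + x * ((x - r) * Q + c) + (- r + r) * c
      ≡⟨ solve 6 (λ a x r -r Q c → a :+ x :* ((x :+ -r) :* Q :+ c) :+ (-r :+ r) :* c
                                  := (x :+ -r) :* (c :+ x :* Q) :+ (a :+ r :* c)) refl a x r (- r) Q c ⟩
    (x - r) * (c + x * Q) + (a + r * c) ∎
    where
    Q = evalMonic (divideByRoot r bs) x
    c = evalMonic (b ∷ bs) r

  length-roots≤degree : ∀ as rs → Unique rs → All (λ r → evalMonic as r ≡ 0#) rs → length rs ≤ length as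
  length-roots≤degree as       []       _           _           = z≤n
  length-roots≤degree []       (r ∷ rs) _           (1≡0 ∷ _)   = ⊥-elim (0≢1 (sym 1≡0))
  length-roots≤degree (a ∷ as) (r ∷ rs) (r∉rs ∷ rs!) (root ∷ roots) =
    s≤s (subst (length rs ≤_) (length-divideByRoot r as)
      (length-roots≤degree (divideByRoot r as) rs rs! (All.zipWith quotient-root (r∉rs , roots))))
    where
    quotient-root : ∀ {s} → r ≢ s × evalMonic (a ∷ as) s ≡ 0# → evalMonic (divideByRoot r as) s ≡ 0#
    quotient-root {s} (r≢s , root-s) = x*y≡0⇒y≡0 (r≢s ∘ sym ∘ x∙y⁻¹≈ε⇒x≈y s r) (begin
      (s - r) * evalMonic (divideByRoot r as) s                            ≡⟨ +-identityʳ _ ⟨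
      (s - r) * evalMonic (divideByRoot r as) s + 0#                       ≡⟨ cong ((s - r) * evalMonic (divideByRoot r as) s +_) root ⟨
      (s - r) * evalMonic (divideByRoot r as) s + evalMonic (a ∷ as) r    ≡⟨ evalMonic-divideByRoot r a as s ⟨
      evalMonic (a ∷ as) s                                                ≡⟨ root-s ⟩
      0#                                                                  ∎)

  evalMonic-x^n-c : ∀ n c x → evalMonic (- c ∷ replicate n 0#) x ≡ x ^ suc n - c
  evalMonic-x^n-c n c x = trans (+-comm (- c) _) (cong (λ y → x * y - c) (x^n n))
    where
    x^n : ∀ n → evalMonic (replicate n 0#) x ≡ x ^ n
    x^n zero    = refl
    x^n (suc n) = trans (+-identityˡ _) (cong (x *_) (x^n n))

  count-x^n≡c≤n : ∀ {n} → 1 ≤ n → ∀ c → countB (λ x → does ((x ^ n) ≟ c)) elements ≤ n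
  count-x^n≡c≤n {suc n} _ c = subst₂ _≤_ (sym (countB≡length∘filter (λ x → (x ^ suc n) ≟ c) elements))
    (cong suc (List.length-replicate n))
    (length-roots≤degree (- c ∷ replicate n 0#) roots
      (Unique.filter⁺ (λ x → (x ^ suc n) ≟ c) {elements} enumerate-unique) (All.tabulate is-root))
    where
    roots = filter (λ x → (x ^ suc n) ≟ c) elements
    is-root : ∀ {x} → x ∈ roots → evalMonic (- c ∷ replicate n 0#) x ≡ 0#
    is-root {x} x∈roots = trans (evalMonic-x^n-c n c x)
      (trans (cong (_- c) (proj₂ (∈-filter⁻ (λ x → (x ^ suc n) ≟ c) {xs = elements} x∈roots))) (-‿inverseʳ c))

  product : List Carrier → Carrier
  product = foldr _*_ 1#

  product-map-* : ∀ c xs → product (map (c *_) xs) ≡ c ^ length xs * product xs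
  product-map-* c []       = sym (*-identityˡ 1#)
  product-map-* c (x ∷ xs) = trans (cong ((c * x) *_) (product-map-* c xs))
    (solve 4 (λ c x cⁿ P → (c :* x) :* (cⁿ :* P) := (c :* cⁿ) :* (x :* P)) refl c x (c ^ length xs) (product xs))

  product-≢0 : ∀ {xs} → All (_≢ 0#) xs → product xs ≢ 0#
  product-≢0 []            1≡0 = 0≢1 (sym 1≡0)
  product-≢0 (x≢0 ∷ xs≢0)     = *-≢0 x≢0 (product-≢0 xs≢0)

  units : List Carrier
  units = filter (λ x → ¬? (x ≟ 0#)) elements

  units-unique : Unique units
  units-unique = Unique.filter⁺ (λ x → ¬? (x ≟ 0#)) {elements} enumerate-unique

  ∈-units⁺ : ∀ {x} → x ≢ 0# → x ∈ units
  ∈-units⁺ {x} x≢0 = ∈-filter⁺ (λ x → ¬? (x ≟ 0#)) (∈-enumerate x) x≢0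

  ∈-units⁻ : ∀ {x} → x ∈ units → x ≢ 0#
  ∈-units⁻ = proj₂ ∘ ∈-filter⁻ (λ x → ¬? (x ≟ 0#)) {xs = elements}

  -- Multiplication by a unit permutes the units, so xⁿ fixes their (nonzero) product.
  fermat : ∀ {n x} → q ≡ suc n → x ≢ 0# → x ^ n ≡ 1#
  fermat {n} {x} q≡1+n x≢0 = subst (λ k → x ^ k ≡ 1#) #units≡n
    (x*y≡y⇒x≡1 (product-≢0 (All.tabulate ∈-units⁻)) (begin
      x ^ length units * product units ≡⟨ product-map-* x units ⟨
      product (map (x *_) units)       ≡⟨ Perm.foldr-commMonoid (setoid Carrier) *-isCommutativeMonoid (↭⇒↭ₛ x*-permutes) ⟩
      product units                    ∎))
    where
    #units≡n : length units ≡ n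
    #units≡n = ℕ.suc-injective (begin
      suc (length units)                    ≡⟨ cong suc (countB≡length∘filter (λ x → ¬? (x ≟ 0#)) elements) ⟨
      suc (countB (not ∘ isZero) elements) ≡⟨ suc-count-nonzero ⟩
      q                                     ≡⟨ q≡1+n ⟩
      suc n                                 ∎)
    x*-permutes : map (x *_) units ↭ units
    x*-permutes = ↭-unique (Unique.map⁺ (*-cancelˡ x≢0) units-unique) units-unique (mk⇔ into onto)
      where
      into : ∀ {y} → y ∈ map (x *_) units → y ∈ units
      into y∈ with ∈-map⁻ (x *_) y∈
      ... | z , z∈units , refl = ∈-units⁺ (*-≢0 x≢0 (∈-units⁻ z∈units))
      onto : ∀ {y} → y ∈ units → y ∈ map (x *_) units
      onto {y} y∈units = subst (_∈ map (x *_) units) (x*[y*z]≡z (⁻¹-inverse x x≢0) y)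
        (∈-map⁺ (x *_) (∈-units⁺ (*-≢0 (⁻¹-≢0 x≢0) (∈-units⁻ y∈units))))

  -- If 2 = 0 then x ↦ x + 1 is a fixed-point-free involution.
  ¬2∣q⇒2#≢0 : ¬ 2 ∣ q → 2# ≢ 0#
  ¬2∣q⇒2#≢0 q-odd 2≡0 = q-odd (Enumeration.involution-even enumeration (_+ 1#) +1+1 +1≢id)
    where
    +1+1 : ∀ x → x + 1# + 1# ≡ x
    +1+1 x = trans (+-assoc x 1# 1#) (trans (cong (x +_) 2≡0) (+-identityʳ x))
    +1≢id : ∀ x → x + 1# ≢ x
    +1≢id x x+1≡x = 0≢1 (sym (identityʳ-unique x 1# x+1≡x))

  half-difference+half-sum : 2# ≢ 0# → ∀ x y → (x - y) ÷ 2# + (x + y) ÷ 2# ≡ x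
  half-difference+half-sum 2≢0 x y = begin
    (x - y) * 2# ⁻¹ + (x + y) * 2# ⁻¹
      ≡⟨ solve 4 (λ x y -y h → (x :+ -y) :* h :+ (x :+ y) :* h := (con 1 :+ con 1) :* h :* x :+ (-y :+ y) :* h)
                 refl x y (- y) (2# ⁻¹) ⟩
    2# * 2# ⁻¹ * x + (- y + y) * 2# ⁻¹  ≡⟨ x+0*y≡x _ (2# ⁻¹) (-‿inverseˡ y) ⟩
    2# * 2# ⁻¹ * x                      ≡⟨ cong (_* x) (⁻¹-inverse 2# 2≢0) ⟩
    1# * x                              ≡⟨ *-identityˡ x ⟩
    x                                   ∎

  module _ (f : Carrier → Carrier) where
    open Cycles _==_ f

    iter-multiplier : ∀ (P : Carrier → Set) {w} → (∀ {y} → P y → f y ≡ w * y) → (∀ {y} → P y → P (f y)) →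
      ∀ {x} → P x → ∀ j → iter f j x ≡ w ^ j * x
    iter-multiplier P {w} f≡w* preserves {x} Px zero    = sym (*-identityˡ x)
    iter-multiplier P {w} f≡w* preserves {x} Px (suc j) = begin
      f (iter f j x)      ≡⟨ f≡w* (iter-preserves P f preserves Px j) ⟩
      w * iter f j x      ≡⟨ cong (w *_) (iter-multiplier P f≡w* preserves Px j) ⟩
      w * (w ^ j * x)     ≡⟨ *-assoc w (w ^ j) x ⟨
      w * w ^ j * x       ∎

    onCycleOfLength-multiplier : ∀ {w m x} → HasOrder w m → x ≢ 0# → (∀ j → iter f j x ≡ w ^ j * x) →
      ∀ ℓ → onCycleOfLength ℓ x ≡ (ℓ ℕ.≡ᵇ m)
    onCycleOfLength-multiplier {w} {m} {x} (1≤m , wᵐ≡1 , below-m) x≢0 iter≡ =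
      onCycleOfLength-period _==_ f x m 1≤m
        (==-true (trans (iter≡ m) (trans (cong (_* x) wᵐ≡1) (*-identityˡ x))))
        (λ j 1≤j j<m → ==-false (below-m j 1≤j j<m ∘ x*y≡y⇒x≡1 x≢0 ∘ trans (sym (iter≡ j))))

    onCycleOfLength-fixedPoint : ∀ {x} → f x ≡ x → ∀ ℓ → onCycleOfLength ℓ x ≡ (ℓ ℕ.≡ᵇ 1)
    onCycleOfLength-fixedPoint fx≡x = onCycleOfLength-period _==_ f _ 1 ℕ.≤-refl (==-true fx≡x)
      (λ { j 1≤j (s≤s j≤0) → ⊥-elim (ℕ.<⇒≱ 1≤j j≤0) })

module Binomial {q : ℕ} (F : FiniteField q) (K : ℕ) (1≤K : 1 ≤ K) (q≡1+2K : q ≡ ℕ.suc (K ℕ.+ K)) where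
  open import Algebra.Bundles using (CommutativeRing)
  open import Algebra.Structures using (IsCommutativeRing)
  import Algebra.Properties.Ring as RingProperties
  import Algebra.Properties.AbelianGroup as AbelianGroupProperties
  open import Data.Bool using (Bool; true)
  open import Data.List using (length)
  open import Data.Nat as ℕ using (ℕ; suc; _≤_; _≡ᵇ_; _/_)
  import Data.Nat.Properties as ℕ
  open import Data.Nat.Divisibility using (_∣_)
  open import Data.Product using (_,_)
  open import Data.Sum using (_⊎_; inj₁; inj₂)
  open import Function using (_∘_)
  open import Function.Definitions using (Bijective)
  open import Function.Consequences.Propositional
    using (inverseᵇ⇒bijective; strictlyInverseˡ⇒inverseˡ; strictlyInverseʳ⇒inverseʳ)
  open import Relation.Binary.PropositionalEquality
  open import Relation.Nullary using (¬_; does; yes; no)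
  open import Relation.Nullary.Decidable using (dec-true; dec-false)
  open FiniteField F
  open FiniteFieldProperties F
  open IsCommutativeRing isCommutativeRing using (+-comm; *-comm; zeroʳ; *-identityˡ; *-identityʳ)
  open CommutativeRing commutativeRing using (ring; +-abelianGroup)
  open RingProperties ring using (-‿distribˡ-*; -‿distribʳ-*)
  open AbelianGroupProperties +-abelianGroup using (⁻¹-anti-homo‿-)
  open import Algebra.Solver.Ring.NaturalCoefficients.Default (CommutativeRing.commutativeSemiring commutativeRing)
  open Enumeration enumeration using (length-enumerate)
  open ≡-Reasoning

  2#≢0 : 2# ≢ 0#
  2#≢0 = ¬2∣q⇒2#≢0 (subst (λ n → ¬ 2 ∣ n) (sym q≡1+2K) (odd⇒¬2∣ K))

  euler : ∀ {x} → x ≢ 0# → x ^ K ≡ 1# ⊎ x ^ K ≡ - 1#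
  euler {x} x≢0 = x*x≡1⇒x≡±1 (x ^ K) (trans (sym (^-homo-* x K K)) (fermat q≡1+2K x≢0))

  ^K-invariant : ∀ {w} x → w ^ K ≡ 1# → (w * x) ^ K ≡ x ^ K
  ^K-invariant {w} x wᴷ≡1 = trans (^-distrib-* w x K) (trans (cong (_* x ^ K) wᴷ≡1) (*-identityˡ _))

  inverse-^K≡1 : ∀ {w w′} → w′ * w ≡ 1# → w ^ K ≡ 1# → w′ ^ K ≡ 1#
  inverse-^K≡1 {w} {w′} w′w≡1 wᴷ≡1 = begin
    w′ ^ K        ≡⟨ ^K-invariant w′ wᴷ≡1 ⟨
    (w * w′) ^ K  ≡⟨ cong (_^ K) (trans (*-comm w w′) w′w≡1) ⟩
    1# ^ K        ≡⟨ 1^n≡1 K ⟩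
    1#            ∎

  exponent : (q ℕ.+ 1) / 2 ≡ suc K
  exponent = trans (cong (λ n → (n ℕ.+ 1) / 2) q≡1+2K) ([1+2n+1]/2≡1+n K)

  binomial : Carrier → Carrier → Carrier → Carrier
  binomial u v x = (v - u) ÷ 2# * x ^ ((q ℕ.+ 1) / 2) + (u + v) ÷ 2# * x

  binomial-factor : ∀ u v x → binomial u v x ≡ ((v - u) ÷ 2# * x ^ K + (u + v) ÷ 2#) * x
  binomial-factor u v x = trans (cong (λ e → (v - u) ÷ 2# * x ^ e + (u + v) ÷ 2# * x) exponent) (
    solve 4 (λ a b x xᴷ → a :* (x :* xᴷ) :+ b :* x := (a :* xᴷ :+ b) :* x) refl ((v - u) ÷ 2#) ((u + v) ÷ 2#) x (x ^ K))

  binomial-0 : ∀ u v → binomial u v 0# ≡ 0#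
  binomial-0 u v = trans (binomial-factor u v 0#) (zeroʳ _)

  binomial-residue : ∀ u v {x} → x ^ K ≡ 1# → binomial u v x ≡ v * x
  binomial-residue u v {x} xᴷ≡1 = trans (binomial-factor u v x) (cong (_* x) (begin
    (v - u) ÷ 2# * x ^ K + (u + v) ÷ 2#  ≡⟨ cong₂ (λ y z → (v - u) ÷ 2# * y + z ÷ 2#) xᴷ≡1 (+-comm u v) ⟩
    (v - u) ÷ 2# * 1# + (v + u) ÷ 2#     ≡⟨ cong (_+ (v + u) ÷ 2#) (*-identityʳ _) ⟩
    (v - u) ÷ 2# + (v + u) ÷ 2#          ≡⟨ half-difference+half-sum 2#≢0 v u ⟩
    v                                     ∎))

  binomial-nonresidue : ∀ u v {x} → x ^ K ≡ - 1# → binomial u v x ≡ u * x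
  binomial-nonresidue u v {x} xᴷ≡-1 = trans (binomial-factor u v x) (cong (_* x) (begin
    (v - u) * 2# ⁻¹ * x ^ K + (u + v) * 2# ⁻¹     ≡⟨ cong (λ y → (v - u) * 2# ⁻¹ * y + (u + v) * 2# ⁻¹) xᴷ≡-1 ⟩
    (v - u) * 2# ⁻¹ * - 1# + (u + v) * 2# ⁻¹      ≡⟨ cong (_+ (u + v) * 2# ⁻¹) (-‿distribʳ-* _ 1#) ⟨
    - ((v - u) * 2# ⁻¹ * 1#) + (u + v) * 2# ⁻¹    ≡⟨ cong (λ y → - y + (u + v) * 2# ⁻¹) (*-identityʳ _) ⟩
    - ((v - u) * 2# ⁻¹) + (u + v) * 2# ⁻¹         ≡⟨ cong (_+ (u + v) * 2# ⁻¹) (-‿distribˡ-* (v - u) (2# ⁻¹)) ⟩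
    - (v - u) * 2# ⁻¹ + (u + v) * 2# ⁻¹           ≡⟨ cong (λ y → y * 2# ⁻¹ + (u + v) * 2# ⁻¹) (⁻¹-anti-homo‿- v u) ⟩
    (u - v) * 2# ⁻¹ + (u + v) * 2# ⁻¹             ≡⟨ half-difference+half-sum 2#≢0 u v ⟩
    u                                              ∎))

  binomial-inverse : ∀ {u v u′ v′} → u′ * u ≡ 1# → v′ * v ≡ 1# → u ^ K ≡ 1# → v ^ K ≡ 1# →
    ∀ x → binomial u′ v′ (binomial u v x) ≡ x
  binomial-inverse {u} {v} {u′} {v′} u′u≡1 v′v≡1 uᴷ≡1 vᴷ≡1 x with x ≟ 0#
  ... | yes refl = trans (cong (binomial u′ v′) (binomial-0 u v)) (binomial-0 u′ v′)
  ... | no x≢0 with euler x≢0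
  ...   | inj₁ xᴷ≡1 = begin
    binomial u′ v′ (binomial u v x) ≡⟨ cong (binomial u′ v′) (binomial-residue u v xᴷ≡1) ⟩
    binomial u′ v′ (v * x)          ≡⟨ binomial-residue u′ v′ (trans (^K-invariant x vᴷ≡1) xᴷ≡1) ⟩
    v′ * (v * x)                    ≡⟨ x*[y*z]≡z v′v≡1 x ⟩
    x                               ∎
  ...   | inj₂ xᴷ≡-1 = begin
    binomial u′ v′ (binomial u v x) ≡⟨ cong (binomial u′ v′) (binomial-nonresidue u v xᴷ≡-1) ⟩
    binomial u′ v′ (u * x)          ≡⟨ binomial-nonresidue u′ v′ (trans (^K-invariant x uᴷ≡1) xᴷ≡-1) ⟩
    u′ * (u * x)                    ≡⟨ x*[y*z]≡z u′u≡1 x ⟩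
    x                               ∎

  -- By Euler's criterion these are the nonzero squares and non-squares; only the power condition is used.
  isResidue isNonresidue : Carrier → Bool
  isResidue    x = does ((x ^ K) ≟ 1#)
  isNonresidue x = does ((x ^ K) ≟ (- 1#))

  classify : ∀ x → OneHot (isZero x) (isNonresidue x) (isResidue x)
  classify x with x ≟ 0#
  ... | yes refl rewrite dec-false ((0# ^ K) ≟ (- 1#)) (λ 0ᴷ≡-1 → -1≢0 (trans (sym 0ᴷ≡-1) (0^n≡0 1≤K)))
                       | dec-false ((0# ^ K) ≟ 1#) (0≢1 ∘ trans (sym (0^n≡0 1≤K))) = first
  ... | no x≢0 with euler x≢0
  ...   | inj₁ xᴷ≡1  rewrite dec-true ((x ^ K) ≟ 1#) xᴷ≡1
                          | dec-false ((x ^ K) ≟ (- 1#)) (1≢-1 2#≢0 ∘ trans (sym xᴷ≡1)) = third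
  ...   | inj₂ xᴷ≡-1 rewrite dec-true ((x ^ K) ≟ (- 1#)) xᴷ≡-1
                          | dec-false ((x ^ K) ≟ 1#) (1≢-1 2#≢0 ∘ sym ∘ trans (sym xᴷ≡-1)) = second

  nonresidues+residues : countB isNonresidue elements ℕ.+ countB isResidue elements ≡ K ℕ.+ K
  nonresidues+residues = ℕ.suc-injective (begin
    suc (N ℕ.+ R)                     ≡⟨ cong (λ z → z ℕ.+ N ℕ.+ R) count-isZero ⟨
    Z ℕ.+ N ℕ.+ R                     ≡⟨ cong₂ ℕ._+_ (cong₂ ℕ._+_ (ℕ.*-identityʳ Z) (ℕ.*-identityʳ N)) (ℕ.*-identityʳ R) ⟨
    Z ℕ.* 1 ℕ.+ N ℕ.* 1 ℕ.+ R ℕ.* 1  ≡⟨ countB-partition₃ isZero isNonresidue isResidue classify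
                                           (λ _ → true) (λ _ _ → refl) (λ _ _ → refl) (λ _ _ → refl) elements ⟨
    countB (λ _ → true) elements      ≡⟨ countB-true elements ⟩
    length elements                   ≡⟨ length-enumerate ⟩
    q                                 ≡⟨ q≡1+2K ⟩
    suc (K ℕ.+ K)                     ∎)
    where
    Z = countB isZero elements
    N = countB isNonresidue elements
    R = countB isResidue elements

  count-nonresidues : countB isNonresidue elements ≡ K
  count-nonresidues = m+o≡n+n⇒m≡n (count-x^n≡c≤n 1≤K (- 1#)) (count-x^n≡c≤n 1≤K 1#) nonresidues+residues

  count-residues : countB isResidue elements ≡ K
  count-residues = m+o≡n+n⇒m≡n (count-x^n≡c≤n 1≤K 1#) (count-x^n≡c≤n 1≤K (- 1#))
    (trans (ℕ.+-comm (countB isResidue elements) _) nonresidues+residues)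

  module Permutation {u v m₀ m₁ k₀ k₁} (ord-u : HasOrder u m₀) (ord-v : HasOrder v m₁)
           (m₀k₀≡K : m₀ ℕ.* k₀ ≡ K) (m₁k₁≡K : m₁ ℕ.* k₁ ≡ K) where
    open Cycles _==_ (binomial u v)

    uᴷ≡1 : u ^ K ≡ 1#
    uᴷ≡1 = subst (λ n → u ^ n ≡ 1#) m₀k₀≡K (HasOrder⇒^*≡1 ord-u k₀)

    vᴷ≡1 : v ^ K ≡ 1#
    vᴷ≡1 = subst (λ n → v ^ n ≡ 1#) m₁k₁≡K (HasOrder⇒^*≡1 ord-v k₁)

    pointsOnCycles-binomial : ∀ ℓ → pointsOnCycles _==_ (binomial u v) elements ℓ ≡ ℓ ℕ.* cycleType1+ m₀ k₀ m₁ k₁ ℓ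
    pointsOnCycles-binomial ℓ = begin
      countB (onCycleOfLength ℓ) elements
        ≡⟨ countB-partition₃ isZero isNonresidue isResidue classify (onCycleOfLength ℓ)
             on-zero on-nonresidue on-residue elements ⟩
      countB isZero elements ℕ.* [ℓ≡1] ℕ.+ countB isNonresidue elements ℕ.* [ℓ≡m₀]
        ℕ.+ countB isResidue elements ℕ.* [ℓ≡m₁]
        ≡⟨ cong₂ (λ z n → z ℕ.* [ℓ≡1] ℕ.+ n ℕ.* [ℓ≡m₀] ℕ.+ countB isResidue elements ℕ.* [ℓ≡m₁])
                 count-isZero (trans count-nonresidues (sym m₀k₀≡K)) ⟩
      1 ℕ.* [ℓ≡1] ℕ.+ m₀ ℕ.* k₀ ℕ.* [ℓ≡m₀] ℕ.+ countB isResidue elements ℕ.* [ℓ≡m₁]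
        ≡⟨ cong (λ r → 1 ℕ.* [ℓ≡1] ℕ.+ m₀ ℕ.* k₀ ℕ.* [ℓ≡m₀] ℕ.+ r ℕ.* [ℓ≡m₁])
                (trans count-residues (sym m₁k₁≡K)) ⟩
      1 ℕ.* [ℓ≡1] ℕ.+ m₀ ℕ.* k₀ ℕ.* [ℓ≡m₀] ℕ.+ m₁ ℕ.* k₁ ℕ.* [ℓ≡m₁]
        ≡⟨ ℓ*cycleType1+ ℓ m₀ k₀ m₁ k₁ ⟨
      ℓ ℕ.* cycleType1+ m₀ k₀ m₁ k₁ ℓ ∎
      where
      [ℓ≡1] = toℕ (ℓ ≡ᵇ 1)
      [ℓ≡m₀] = toℕ (ℓ ≡ᵇ m₀)
      [ℓ≡m₁] = toℕ (ℓ ≡ᵇ m₁)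

      on-zero : ∀ x → isZero x ≡ true → onCycleOfLength ℓ x ≡ (ℓ ≡ᵇ 1)
      on-zero x x≟0 with does⇒witness (x ≟ 0#) x≟0
      ... | refl = onCycleOfLength-fixedPoint (binomial u v) (binomial-0 u v) ℓ

      on-class : ∀ {c w m} → c ≢ 0# → HasOrder w m → w ^ K ≡ 1# → (∀ {y} → y ^ K ≡ c → binomial u v y ≡ w * y) →
        ∀ x → x ^ K ≡ c → onCycleOfLength ℓ x ≡ (ℓ ≡ᵇ m)
      on-class {c} {w} c≢0 ord-w wᴷ≡1 on-c x xᴷ≡c =
        onCycleOfLength-multiplier (binomial u v) ord-w (x^n≡c⇒x≢0 1≤K c≢0 xᴷ≡c)
          (iter-multiplier (binomial u v) (λ y → y ^ K ≡ c) on-c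
            (λ yᴷ≡c → trans (cong (_^ K) (on-c yᴷ≡c)) (trans (^K-invariant _ wᴷ≡1) yᴷ≡c)) xᴷ≡c)
          ℓ

      on-nonresidue : ∀ x → isNonresidue x ≡ true → onCycleOfLength ℓ x ≡ (ℓ ≡ᵇ m₀)
      on-nonresidue x x≟-1 = on-class -1≢0 ord-u uᴷ≡1 (binomial-nonresidue u v) x (does⇒witness ((x ^ K) ≟ (- 1#)) x≟-1)

      on-residue : ∀ x → isResidue x ≡ true → onCycleOfLength ℓ x ≡ (ℓ ≡ᵇ m₁)
      on-residue x x≟1 = on-class (0≢1 ∘ sym) ord-v vᴷ≡1 (binomial-residue u v) x (does⇒witness ((x ^ K) ≟ 1#) x≟1)

    u≢0 : u ≢ 0#
    u≢0 = x^n≡c⇒x≢0 1≤K (0≢1 ∘ sym) uᴷ≡1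

    v≢0 : v ≢ 0#
    v≢0 = x^n≡c⇒x≢0 1≤K (0≢1 ∘ sym) vᴷ≡1

    binomial-inverseˡ : ∀ x → binomial (u ⁻¹) (v ⁻¹) (binomial u v x) ≡ x
    binomial-inverseˡ = binomial-inverse (⁻¹-inverseˡ u≢0) (⁻¹-inverseˡ v≢0) uᴷ≡1 vᴷ≡1

    binomial-inverseʳ : ∀ x → binomial u v (binomial (u ⁻¹) (v ⁻¹) x) ≡ x
    binomial-inverseʳ = binomial-inverse (⁻¹-inverse u u≢0) (⁻¹-inverse v v≢0)
      (inverse-^K≡1 (⁻¹-inverseˡ u≢0) uᴷ≡1) (inverse-^K≡1 (⁻¹-inverseˡ v≢0) vᴷ≡1)

    binomial-bijective : Bijective _≡_ _≡_ (binomial u v)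
    binomial-bijective = inverseᵇ⇒bijective
      (strictlyInverseˡ⇒inverseˡ (binomial u v) binomial-inverseʳ , strictlyInverseʳ⇒inverseʳ (binomial u v) binomial-inverseˡ)

mainTheorem2 :
    (q : ℕ) → (∃[ p ] ∃[ k ] (Prime p × ¬ (2 ∣ p) × 1 ≤ k × q ≡ Data.Nat._^_ p k)) →
    (F : FiniteField q) → let open FiniteField F in
    (m d : ℕ) → 1 ≤ m → 1 ≤ d → q ∸ 1 ≡ Data.Nat._*_ m d → 2 ∣ d →
    (H₀ : Carrier → Bool) → IsSubgroupOfUnits H₀ → countB H₀ elements ≡ m →
    (u v : Carrier) → H₀ u ≡ true → H₀ v ≡ true → u ≢ v →
    (m₀ m₁ n₀ n₁ : ℕ) → HasOrder u m₀ → HasOrder v m₁ →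
    m ≡ Data.Nat._*_ m₀ n₀ → m ≡ Data.Nat._*_ m₁ n₁ →
    let a = (v - u) ÷ 2#
        b = (u + v) ÷ 2#
        e = Data.Nat._+_ q 1 / 2
        f = λ x → a * x ^ e + b * x
        a′ = (v ⁻¹ - u ⁻¹) ÷ 2#
        b′ = (u ⁻¹ + v ⁻¹) ÷ 2#
        g = λ x → a′ * x ^ e + b′ * x
    in Bijective _≡_ _≡_ f
       × (∀ ℓ → pointsOnCycles _==_ f elements ℓ
                ≡ Data.Nat._*_ ℓ (cycleType1+ m₀ (Data.Nat._*_ d n₀ / 2) m₁ (Data.Nat._*_ d n₁ / 2) ℓ))
       × (∀ x → g (f x) ≡ x) × (∀ x → f (g x) ≡ x)
mainTheorem2 q _ F m d 1≤m 1≤d q∸1≡md (divides t d≡t*2) _ _ _ u v _ _ _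
             m₀ m₁ n₀ n₁ ord-u ord-v m≡m₀n₀ m≡m₁n₁ =
  binomial-bijective , pointsOnCycles-binomial , binomial-inverseˡ , binomial-inverseʳ
  where
  K = m ℕ.* t

  1≤K : 1 ≤ K
  1≤K = ℕ.*-mono-≤ 1≤m (ℕ.n≢0⇒n>0 λ t≡0 → ℕ.<⇒≢ 1≤d (sym (trans d≡t*2 (cong (ℕ._* 2) t≡0))))

  q≡1+2K : q ≡ ℕ.suc (K ℕ.+ K)
  q≡1+2K = trans (FiniteFieldProperties.q≡1+[q∸1] F)
    (cong ℕ.suc (trans q∸1≡md (trans (cong (m ℕ.*_) d≡t*2) (trans (sym (ℕ.*-assoc m t 2)) (sym (n+n≡n*2 K))))))

  open Binomial F K 1≤K q≡1+2K

  k≡K : ∀ mᵢ nᵢ → m ≡ mᵢ ℕ.* nᵢ → mᵢ ℕ.* (d ℕ.* nᵢ / 2) ≡ K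
  k≡K mᵢ nᵢ m≡mᵢnᵢ = trans (cong (λ d → mᵢ ℕ.* (d ℕ.* nᵢ / 2)) d≡t*2)
    (trans (m*[t*2*n/2]≡[m*n]*t mᵢ nᵢ t) (cong (ℕ._* t) (sym m≡mᵢnᵢ)))

  open Permutation ord-u ord-v (k≡K m₀ n₀ m≡m₀n₀) (k≡K m₁ n₁ m≡m₁n₁)
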